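{- Let $G_1$ be a cograph and $x\in V(G_1)$. (a) If $G_2$ is obtained from $G_1$ by adding a true twin $y$ of $x$, then $C(G_1)=C(G_2)$. (b) If $G_3$ is obtained from $G_1$ by adding a false twin $z$ of $x$, then $C(G_1)\le C(G_3)$.
   Context: A cograph is a graph with no induced path on $4$ vertices. Adding a true twin $y$ of $x$ means adding a new vertex $y$ with $N[y]=N[x]$ (so $y$ is adjacent to $x$ and to all neighbors of $x$); adding a false twin $z$ of $x$ means adding a new vertex $z$ with $N(z)=N(x)$. $C(G)$ is the cop number of $G$ in the game of Cops and Robbers (cops choose vertices first, then the robber; players alternate, each moving to an adjacent vertex or staying; capture when a cop occupies the robber's vertex). -}

module Defs where

open import Data.Nat using (ℕ; zero; suc; _≤_)
open import Data.Fin using (Fin; zero; suc)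
open import Data.Vec using (Vec)
open import Data.Vec.Membership.Propositional using (_∈_)
open import Data.Vec.Relation.Binary.Pointwise.Inductive using (Pointwise)
open import Data.Product using (Σ; _×_)
open import Data.Sum using (_⊎_; inj₁; inj₂)
open import Data.Empty using (⊥)
open import Relation.Nullary using (¬_)
open import Relation.Binary.PropositionalEquality using (_≡_; refl; sym)

record Graph (n : ℕ) : Set₁ where
  field
    Adj     : Fin n → Fin n → Set
    symm    : ∀ u v → Adj u v → Adj v u
    irrefl  : ∀ u → ¬ Adj u u
open Graph public

-- Cograph: no induced path a - b - c - d on 4 vertices.
-- (Distinctness of a,b,c,d follows from the adjacency/non-adjacency pattern.)
Cograph : ∀ {n} → Graph n → Set
Cograph G = ∀ a b c d → Adj G a b → Adj G b c → Adj G c d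
          → ¬ Adj G a c → ¬ Adj G b d → ¬ Adj G a d → ⊥

-- Adding a true twin of x: the new vertex is 'zero', old vertex v becomes 'suc v'.
-- N[zero] = N[suc x].
addTrueTwin : ∀ {n} → Graph n → Fin n → Graph (suc n)
addTrueTwin {n} G x = record { Adj = A ; symm = s ; irrefl = i }
  where
  A : Fin (suc n) → Fin (suc n) → Set
  A zero    zero    = ⊥
  A zero    (suc v) = v ≡ x ⊎ Adj G x v
  A (suc u) zero    = u ≡ x ⊎ Adj G u x
  A (suc u) (suc v) = Adj G u v
  s : ∀ u v → A u v → A v u
  s (zero) (zero)  ()
  s (zero) (suc v) (inj₁ e) = inj₁ e
  s (zero) (suc v) (inj₂ a) = inj₂ (symm G _ _ a)
  s (suc u) (zero)  (inj₁ e) = inj₁ e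
  s (suc u) (zero)  (inj₂ a) = inj₂ (symm G _ _ a)
  s (suc u) (suc v) p = symm G _ _ p
  i : ∀ u → ¬ A u u
  i (zero)  ()
  i (suc u) p = irrefl G _ p

addFalseTwin : ∀ {n} → Graph n → Fin n → Graph (suc n)
addFalseTwin {n} G x = record { Adj = A ; symm = s ; irrefl = i }
  where
  A : Fin (suc n) → Fin (suc n) → Set
  A zero    zero    = ⊥
  A zero    (suc v) = Adj G x v
  A (suc u) zero    = Adj G u x
  A (suc u) (suc v) = Adj G u v
  s : ∀ u v → A u v → A v u
  s (zero) (zero)  ()
  s (zero) (suc v) p = symm G _ _ p
  s (suc u) (zero)  p = symm G _ _ p
  s (suc u) (suc v) p = symm G _ _ p
  i : ∀ u → ¬ A u u
  i (zero)  ()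
  i (suc u) p = irrefl G _ p

-- Closed neighbourhood: v ∈ N[u] (a player at u may move to v or stay).
CN : ∀ {n} → Graph n → Fin n → Fin n → Set
CN G u v = u ≡ v ⊎ Adj G u v

-- Win G c r : it is the cops' turn, cops are at positions c, robber at r,
-- and the cops can force capture in finitely many rounds (inductive attractor).
data Win {n : ℕ} (G : Graph n) {k : ℕ} : Vec (Fin n) k → Fin n → Set where
  caught : ∀ {c r} → r ∈ c → Win G c r
  move   : ∀ {c r} (c' : Vec (Fin n) k) → Pointwise (CN G) c c'
         → (r ∈ c' ⊎ (∀ r' → CN G r r' → Win G c' r'))
         → Win G c r

-- k cops have a winning strategy: cops choose initial positions, then the robber
-- chooses, then the cops move first.
CopWin : ∀ {n} → Graph n → ℕ → Set
CopWin {n} G k = Σ (Vec (Fin n) k) λ c → ∀ r → Win G c r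

IsCopNumber : ∀ {n} → Graph n → ℕ → Set
IsCopNumber G k = CopWin G k × (∀ j → CopWin G j → k ≤ j)

module Submission where

-- Cops and Robbers is monotone under two kinds of graph maps, and the twin
-- constructions are instances of both.
--
-- * Retract lemma: if H embeds into G by ι and f : G → H maps closed
--   neighbourhoods into closed neighbourhoods with f ∘ ι = id, then every
--   winning strategy for k cops on G yields one on H.  The cops on H play the
--   images under f of the cops on G, against the robber's image under ι.
-- * Domination lemma: if moreover each v ∈ G satisfies N[v] ⊆ N[ι (f v)],
--   then every winning strategy on H yields one on G.  The cops on G play the
--   images under ι of the cops on H, chasing the robber's shadow f r; once the
--   shadow is caught the cop on ι (f r) reaches the robber in one move.
--
-- Folding the new twin onto x is such a map f for both G₂ = G₁ + true twin and
-- G₃ = G₁ + false twin, so G₁ is a retract of both; for the true twin N[y] = N[x]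
-- so the domination condition holds as well.  Hence C(G₁) ≤ C(G₂) ≤ C(G₁) and
-- C(G₁) ≤ C(G₃).

open import Defs
open import Data.Nat using (suc; _≤_)
open import Data.Nat.Properties using (≤-antisym)
open import Data.Fin using (Fin; zero; suc)
open import Data.Product using (_×_; _,_)
open import Data.Sum using (inj₁; inj₂)
open import Data.Vec using (Vec; []; _∷_; map)
open import Data.Vec.Relation.Unary.Any using (here; there)
open import Data.Vec.Membership.Propositional using (_∈_)
open import Data.Vec.Membership.Propositional.Properties using (∈-map⁺)
open import Data.Vec.Relation.Binary.Pointwise.Inductive as Pointwise
  using (Pointwise; _∷_; map⁺)
open import Relation.Binary.PropositionalEquality using (_≡_; refl; sym; cong; subst)

Preserves : ∀ {m n} → Graph m → Graph n → (Fin m → Fin n) → Set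
Preserves G H f = ∀ u v → CN G u v → CN H (f u) (f v)

Dominates : ∀ {n} → Graph n → Fin n → Fin n → Set
Dominates G u v = ∀ w → CN G v w → CN G u w

moveAlong : ∀ {m n k} (G : Graph m) (H : Graph n) {f : Fin m → Fin n}
          → Preserves G H f → {c c' : Vec (Fin m) k}
          → Pointwise (CN G) c c' → Pointwise (CN H) (map f c) (map f c')
moveAlong _ _ pres = map⁺ (pres _ _)

module OneMoveCapture {n} (G : Graph n) where

  sendTo : ∀ {k} (r : Fin n) {c : Vec (Fin n) k} {b} → b ∈ c → Vec (Fin n) k
  sendTo r {_ ∷ c} (here _)  = r ∷ c
  sendTo r {b ∷ _} (there p) = b ∷ sendTo r p

  sendTo-legal : ∀ {k r b} {c : Vec (Fin n) k}
               → CN G b r → (p : b ∈ c) → Pointwise (CN G) c (sendTo r p)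
  sendTo-legal {c = _ ∷ c} b→r (here refl) = b→r ∷ Pointwise.refl (inj₁ refl)
  sendTo-legal {c = _ ∷ _} b→r (there p)   = inj₁ refl ∷ sendTo-legal b→r p

  sendTo-reaches : ∀ {k r b} {c : Vec (Fin n) k} (p : b ∈ c) → r ∈ sendTo r p
  sendTo-reaches {c = _ ∷ _} (here _)  = here refl
  sendTo-reaches {c = _ ∷ _} (there p) = there (sendTo-reaches p)

  captureFrom : ∀ {k b r} {c : Vec (Fin n) k} → b ∈ c → CN G b r → Win G c r
  captureFrom p b→r = move _ (sendTo-legal b→r p) (inj₁ (sendTo-reaches p))

open OneMoveCapture using (captureFrom)

module Retract {m n} (H : Graph m) (G : Graph n)
               (ι : Fin m → Fin n) (f : Fin n → Fin m)
               (ι-pres : Preserves H G ι) (f-pres : Preserves G H f)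
               (f∘ι : ∀ u → f (ι u) ≡ u) where

  caught-image : ∀ {k r} {c : Vec (Fin n) k} → ι r ∈ c → r ∈ map f c
  caught-image {r = r} p = subst (_∈ _) (f∘ι r) (∈-map⁺ f p)

  pullback : ∀ {k r} {c : Vec (Fin n) k} → Win G c (ι r) → Win H (map f c) r
  pullback (caught p)              = caught (caught-image p)
  pullback (move c' step (inj₁ p)) = move (map f c') (moveAlong G H f-pres step) (inj₁ (caught-image p))
  pullback {r = r} (move c' step (inj₂ next)) =
    move (map f c') (moveAlong G H f-pres step)
         (inj₂ λ r' r→r' → pullback (next (ι r') (ι-pres r r' r→r')))

  copWin : ∀ {k} → CopWin G k → CopWin H k
  copWin (c , win) = map f c , λ r → pullback (win (ι r))

module Domination {m n} (H : Graph m) (G : Graph n)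
                  (ι : Fin m → Fin n) (f : Fin n → Fin m)
                  (ι-pres : Preserves H G ι) (f-pres : Preserves G H f)
                  (dominated : ∀ v → Dominates G (ι (f v)) v) where

  finish : ∀ {k r} {c : Vec (Fin m) k} → f r ∈ c → Win G (map ι c) r
  finish {r = r} p = captureFrom G (∈-map⁺ ι p) (dominated r r (inj₁ refl))

  pushforward : ∀ {k r} {c : Vec (Fin m) k} → Win H c (f r) → Win G (map ι c) r
  pushforward (caught p)              = finish p
  pushforward {r = r} (move c' step (inj₁ p)) =
    move (map ι c') (moveAlong H G ι-pres step)
         (inj₂ λ r' r→r' → captureFrom G (∈-map⁺ ι p) (dominated r r' r→r'))
  pushforward {r = r} (move c' step (inj₂ next)) =
    move (map ι c') (moveAlong H G ι-pres step)
         (inj₂ λ r' r→r' → pushforward (next (f r') (f-pres r r' r→r')))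

  copWin : ∀ {k} → CopWin H k → CopWin G k
  copWin (c , win) = map ι c , λ r → pushforward (win (f r))

copNumber-mono : ∀ {m n} {G : Graph m} {H : Graph n} {j k}
               → (∀ {i} → CopWin G i → CopWin H i)
               → IsCopNumber H j → IsCopNumber G k → j ≤ k
copNumber-mono transfer (_ , minimal) (winG , _) = minimal _ (transfer winG)

module Twins {n} (G₁ : Graph n) (x : Fin n) where

  G₂ G₃ : Graph (suc n)
  G₂ = addTrueTwin G₁ x
  G₃ = addFalseTwin G₁ x

  fold : Fin (suc n) → Fin n
  fold zero    = x
  fold (suc v) = v

  embed : (G : Graph (suc n)) → (∀ u v → Adj G₁ u v → Adj G (suc u) (suc v))
        → Preserves G₁ G suc
  embed _ adj u v (inj₁ u≡v) = inj₁ (cong suc u≡v)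
  embed _ adj u v (inj₂ a)   = inj₂ (adj u v a)

  fold-true : Preserves G₂ G₁ fold
  fold-true u       .u      (inj₁ refl)         = inj₁ refl
  fold-true zero    (suc v) (inj₂ (inj₁ v≡x)) = inj₁ (sym v≡x)
  fold-true zero    (suc v) (inj₂ (inj₂ a))   = inj₂ a
  fold-true (suc u) zero    (inj₂ (inj₁ u≡x)) = inj₁ u≡x
  fold-true (suc u) zero    (inj₂ (inj₂ a))   = inj₂ a
  fold-true (suc u) (suc v) (inj₂ a)          = inj₂ a

  fold-false : Preserves G₃ G₁ fold
  fold-false u       .u      (inj₁ refl) = inj₁ refl
  fold-false zero    (suc v) (inj₂ a)    = inj₂ a
  fold-false (suc u) zero    (inj₂ a)    = inj₂ a
  fold-false (suc u) (suc v) (inj₂ a)    = inj₂ a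

  true-dominated : ∀ v → Dominates G₂ (suc (fold v)) v
  true-dominated zero    .zero   (inj₁ refl)        = inj₂ (inj₁ refl)
  true-dominated zero    (suc w) (inj₂ (inj₁ refl)) = inj₁ refl
  true-dominated zero    (suc w) (inj₂ (inj₂ a))    = inj₂ a
  true-dominated (suc v) w       v→w                = v→w

  G₂→G₁ : ∀ {k} → CopWin G₂ k → CopWin G₁ k
  G₂→G₁ = Retract.copWin G₁ G₂ suc fold (embed G₂ λ _ _ a → a) fold-true λ _ → refl

  G₁→G₂ : ∀ {k} → CopWin G₁ k → CopWin G₂ k
  G₁→G₂ = Domination.copWin G₁ G₂ suc fold (embed G₂ λ _ _ a → a) fold-true true-dominated

  G₃→G₁ : ∀ {k} → CopWin G₃ k → CopWin G₁ k
  G₃→G₁ = Retract.copWin G₁ G₃ suc fold (embed G₃ λ _ _ a → a) fold-false λ _ → refl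

proposition3p1 : ∀ {n} (G₁ : Graph n) (x : Fin n) → Cograph G₁
    → (∀ k₁ k₂ → IsCopNumber G₁ k₁ → IsCopNumber (addTrueTwin G₁ x) k₂ → k₁ ≡ k₂)
    × (∀ k₁ k₃ → IsCopNumber G₁ k₁ → IsCopNumber (addFalseTwin G₁ x) k₃ → k₁ ≤ k₃)
proposition3p1 G₁ x _ = trueTwin , falseTwin
  where
  open Twins G₁ x
  trueTwin : ∀ k₁ k₂ → IsCopNumber G₁ k₁ → IsCopNumber G₂ k₂ → k₁ ≡ k₂
  trueTwin _ _ C₁ C₂ = ≤-antisym (copNumber-mono G₂→G₁ C₁ C₂) (copNumber-mono G₁→G₂ C₂ C₁)
  falseTwin : ∀ k₁ k₃ → IsCopNumber G₁ k₁ → IsCopNumber G₃ k₃ → k₁ ≤ k₃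
  falseTwin _ _ C₁ C₃ = copNumber-mono G₃→G₁ C₁ C₃
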